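{- Certificate complexity does not always bound rank from above: for $k\ge 1$ and $n=4^k$, the function $f=(\mathrm{AND}_2\circ\mathrm{OR}_2)^{\otimes k}$ on $n$ variables satisfies $\mathrm{Rank}(f)=\Omega(\mathrm{C}(f)^2)$ (i.e. there is an absolute constant $c>0$ with $\mathrm{Rank}(f)\ge c\,\mathrm{C}(f)^2$ for all $k\ge1$).
   Context: $\mathrm{AND}_2\circ\mathrm{OR}_2(x_1,x_2,x_3,x_4)=(x_1\vee x_2)\wedge(x_3\vee x_4)$. For $f$ on $n$ variables and $g$ on $m$ variables, $f\circ g(a^1,\dots,a^n)=f(g(a^1),\dots,g(a^n))$; $h^{\otimes1}=h$, $h^{\otimes k}=h\circ h^{\otimes(k-1)}$. For an input $a$, $\mathrm{C}(f,a)$ is the minimum size of a set $S$ of coordinates such that every $a'$ agreeing with $a$ on $S$ has $f(a')=f(a)$; $\mathrm{C}(f)=\max_a\mathrm{C}(f,a)$. A decision tree queries single variables and has $0/1$ leaves. Rank of a rooted binary tree: leaves have rank $0$; an internal node with children of ranks $a,b$ has rank $a+1$ if $a=b$, else $\max\{a,b\}$; $\mathrm{Rank}(f)$ is the minimum rank of a decision tree computing $f$. -}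

module Defs where

open import Data.Nat using (ℕ; zero; suc; _*_; _^_; _≤_)
open import Data.Bool using (Bool; true; false; _∧_; _∨_; if_then_else_)
open import Data.Fin using (Fin; zero; suc; combine)
open import Data.Fin.Subset using (Subset; _∈_; ∣_∣)
open import Data.Product using (Σ; ∃; _×_; _,_)
open import Relation.Binary.PropositionalEquality using (_≡_)

Input : ℕ → Set
Input n = Fin n → Bool

BoolFn : ℕ → Set
BoolFn n = Input n → Bool

andOr : BoolFn 4
andOr x = (x zero ∨ x (suc zero)) ∧ (x (suc (suc zero)) ∨ x (suc (suc (suc zero))))

_⊚_ : ∀ {n m} → BoolFn n → BoolFn m → BoolFn (n * m)
(f ⊚ g) x = f (λ i → g (λ j → x (combine i j)))

-- Tensor power: tensor h k = h^{⊗(k+1)} on m ^ (k+1) variables.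
-- h^{⊗1} = h, h^{⊗(k+1)} = h ∘ h^{⊗k}.
tensor : ∀ {m} → BoolFn m → (k : ℕ) → BoolFn (m ^ suc k)
tensor {m} h zero x = h (λ j → x (combine j zero))
  -- m ^ 1 = m * 1 definitionally; variable j of h is (j , 0)
tensor h (suc k) = h ⊚ tensor h k

IsCertificate : ∀ {n} → BoolFn n → Input n → Subset n → Set
IsCertificate {n} f a S =
  ∀ (a' : Input n) → (∀ i → i ∈ S → a' i ≡ a i) → f a' ≡ f a

IsCertAt : ∀ {n} → BoolFn n → Input n → ℕ → Set
IsCertAt f a c =
  (Σ _ λ S → IsCertificate f a S × ∣ S ∣ ≡ c)
  × (∀ S → IsCertificate f a S → c ≤ ∣ S ∣)

IsCert : ∀ {n} → BoolFn n → ℕ → Set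
IsCert {n} f c =
  (Σ (Input n) λ a → IsCertAt f a c)
  × (∀ a c' → IsCertAt f a c' → c' ≤ c)

data DTree (n : ℕ) : Set where
  leaf  : Bool → DTree n
  query : Fin n → DTree n → DTree n → DTree n

eval : ∀ {n} → DTree n → Input n → Bool
eval (leaf b) x = b
eval (query i t₀ t₁) x = if x i then eval t₁ x else eval t₀ x

Computes : ∀ {n} → DTree n → BoolFn n → Set
Computes {n} t f = ∀ (x : Input n) → eval t x ≡ f x

rankNode : ℕ → ℕ → ℕ
rankNode zero zero = 1
rankNode zero (suc b) = suc b
rankNode (suc a) zero = suc a
rankNode (suc a) (suc b) = suc (rankNode a b)

rank : ∀ {n} → DTree n → ℕ
rank (leaf _) = 0
rank (query _ t₀ t₁) = rankNode (rank t₀) (rank t₁)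

IsRank : ∀ {n} → BoolFn n → ℕ → Set
IsRank {n} f r =
  (Σ (DTree n) λ t → Computes t f × rank t ≡ r)
  × (∀ t → Computes t f → r ≤ rank t)

{-# OPTIONS --safe #-}
module Submission where

-- At an input of value 1, AND₂ ∘ OR₂ is certified by one
-- true variable of each OR; at an input of value 0, by both variables of a false
-- OR.  These certificates only use coordinates carrying the output value, and
-- such monochromatic certificates multiply under composition, so the (k+1)-fold
-- tensor power f has C(f) ≤ 2^(k+1).
--
-- An adversary assigns to every restriction of f a
-- profile: the constant value of the restricted function, or "live p", a lower
-- bound p + 1 on its rank.  Profiles are computed block by block from
-- Rank (g ∧ h), Rank (g ∨ h) ≥ Rank g + Rank h − 1 (g, h on disjoint variables),
-- starting from rank 2 for (x₀ ∨ x₁) ∧ (x₂ ∨ x₃).  Fixing a free variable changes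
-- the profile only as the recursion defining rank permits, so by induction on
-- the tree every decision tree for f has rank > 4^k.  Hence C(f)² ≤ 4^(k+1) < 4 Rank(f).

open import Defs
open import Data.Bool using (Bool; true; false; not; _∧_; _∨_; if_then_else_)
import Data.Bool as Bool
open import Data.Bool.Properties
  using (not-injective; not-involutive; not-¬; ∧-zeroʳ; ∨-zeroʳ; ∧-identityʳ;
         ∧-conicalˡ; ∧-conicalʳ; ∨-conicalˡ; ∨-conicalʳ)
open import Data.Empty using (⊥-elim)
open import Data.Fin using (Fin; zero; suc; combine; remQuot; _↑ˡ_; _↑ʳ_)
open import Data.Fin.Patterns using (0F; 1F; 2F; 3F)
open import Data.Fin.Properties
  using (_≟_; all?; remQuot-combine; combine-remQuot; combine-injectiveˡ; combine-injectiveʳ)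
open import Data.Fin.Subset using (Subset; _∈_; ∣_∣; inside; outside; ⊤; ⁅_⁆) renaming (⊥ to ∅)
open import Data.Fin.Subset.Properties using (∉⊥; ∣⊥∣≡0; ∈⊤; ∣⊤∣≡n; x∈⁅x⁆; x∈⁅y⁆⇒x≡y; ∣⁅x⁆∣≡1)
open import Data.Maybe using (Maybe; just; nothing)
open import Data.Maybe.Properties using (just-injective)
open import Data.Nat using (ℕ; zero; suc; _+_; _*_; _^_; _<_; _≤_; z≤n; s≤s; s≤s⁻¹)
import Data.Nat as ℕ
open import Data.Nat.Properties
  using (≤-refl; ≤-reflexive; ≤-trans; <⇒≤; n≤1+n; +-comm; +-assoc; +-identityʳ; +-suc;
         +-mono-≤; +-monoˡ-≤; +-monoʳ-≤; *-identityˡ; *-mono-≤; *-monoˡ-≤; *-monoʳ-≤;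
         ^-distribˡ-+-*; ^-*-assoc; module ≤-Reasoning)
open import Data.Product using (Σ; ∃₂; _×_; _,_; proj₁; proj₂; uncurry)
open import Data.Sum using (_⊎_; inj₁; inj₂)
import Data.Sum as Sum
open import Data.Unit using (tt) renaming (⊤ to Unit)
open import Data.Vec using ([]; _∷_; _++_; lookup; here; there)
open import Data.Vec.Functional using (updateAt)
open import Data.Vec.Functional.Properties using (updateAt-updates; updateAt-minimal)
open import Function using (const; _∘_; case_of_)
open import Relation.Binary.PropositionalEquality
open import Relation.Nullary using (Dec; yes; no; ¬?)
open import Relation.Nullary.Decidable using (map′; _×-dec_; _→-dec_; from-yes)

a≤rankNode : ∀ a b → a ≤ rankNode a b
a≤rankNode zero b = z≤n
a≤rankNode (suc a) zero = ≤-refl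
a≤rankNode (suc a) (suc b) = s≤s (a≤rankNode a b)

b≤rankNode : ∀ a b → b ≤ rankNode a b
b≤rankNode zero zero = z≤n
b≤rankNode zero (suc b) = ≤-refl
b≤rankNode (suc a) zero = z≤n
b≤rankNode (suc a) (suc b) = s≤s (b≤rankNode a b)

1≤rankNode : ∀ a b → 1 ≤ rankNode a b
1≤rankNode zero zero = s≤s z≤n
1≤rankNode zero (suc b) = s≤s z≤n
1≤rankNode (suc a) zero = s≤s z≤n
1≤rankNode (suc a) (suc b) = s≤s z≤n

rankNode-mono-≤ : ∀ {a a' b b'} → a ≤ a' → b ≤ b' → rankNode a b ≤ rankNode a' b'
rankNode-mono-≤ {zero} {a'} {zero} {b'} _ _ = 1≤rankNode a' b'
rankNode-mono-≤ {zero} {a'} {suc b} {b'} _ q = ≤-trans q (b≤rankNode a' b')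
rankNode-mono-≤ {suc a} {a'} {zero} {b'} p _ = ≤-trans p (a≤rankNode a' b')
rankNode-mono-≤ {suc a} {suc a'} {suc b} {suc b'} (s≤s p) (s≤s q) = s≤s (rankNode-mono-≤ p q)

rankNode-diag : ∀ a → rankNode a a ≡ suc a
rankNode-diag zero = refl
rankNode-diag (suc a) = cong suc (rankNode-diag a)

rankNode-+ : ∀ q a b → rankNode (q + a) (q + b) ≡ q + rankNode a b
rankNode-+ zero a b = refl
rankNode-+ (suc q) a b = cong suc (rankNode-+ q a b)

-- Profiles

-- The profile of a restricted function: fixed b if it is constantly b, live p
-- if it is not constant, p + 1 being a lower bound on its rank.
data Profile : Set where
  fixed : Bool → Profile
  live  : ℕ → Profile

weight : Profile → ℕ
weight (fixed _) = 0
weight (live p) = suc p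

Attains : Profile → Bool → Set
Attains (fixed b) v = v ≡ b
Attains (live _) v = Unit

NotSameFixed : Profile → Profile → Set
NotSameFixed (fixed b) (fixed b') = b ≢ b'
NotSameFixed _ _ = Unit

-- Admissible profiles of the restrictions x = 0 and x = 1, for a free variable
-- x, of a function with profile s; the live clause mirrors the recursion of rank.
Splits : Profile → Profile → Profile → Set
Splits (fixed b) s₀ s₁ = s₀ ≡ fixed b × s₁ ≡ fixed b
Splits (live p) s₀ s₁ = suc p ≤ rankNode (weight s₀) (weight s₁) × NotSameFixed s₀ s₁

splits-refl : ∀ s → Splits s s s
splits-refl (fixed b) = refl , refl
splits-refl (live p) = subst (suc p ≤_) (sym (rankNode-diag (suc p))) (n≤1+n (suc p)) , tt

-- live p ∧ᵖ live q = live (p + q): for g, h on disjoint variables,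
-- Rank (g ∧ h) ≥ Rank g + Rank h − 1.
infixr 6 _∧ᵖ_
infixr 5 _∨ᵖ_

_∧ᵖ_ : Profile → Profile → Profile
fixed false ∧ᵖ t = fixed false
fixed true ∧ᵖ t = t
live p ∧ᵖ fixed false = fixed false
live p ∧ᵖ fixed true = live p
live p ∧ᵖ live q = live (p + q)

¬ᵖ_ : Profile → Profile
¬ᵖ fixed b = fixed (not b)
¬ᵖ live p = live p

_∨ᵖ_ : Profile → Profile → Profile
s ∨ᵖ t = ¬ᵖ (¬ᵖ s ∧ᵖ ¬ᵖ t)

∧ᵖ-comm : ∀ s t → s ∧ᵖ t ≡ t ∧ᵖ s
∧ᵖ-comm (fixed false) (fixed false) = refl
∧ᵖ-comm (fixed false) (fixed true) = refl
∧ᵖ-comm (fixed false) (live q) = refl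
∧ᵖ-comm (fixed true) (fixed false) = refl
∧ᵖ-comm (fixed true) (fixed true) = refl
∧ᵖ-comm (fixed true) (live q) = refl
∧ᵖ-comm (live p) (fixed false) = refl
∧ᵖ-comm (live p) (fixed true) = refl
∧ᵖ-comm (live p) (live q) = cong live (+-comm p q)

∧ᵖ-identityʳ : ∀ s → s ∧ᵖ fixed true ≡ s
∧ᵖ-identityʳ (fixed false) = refl
∧ᵖ-identityʳ (fixed true) = refl
∧ᵖ-identityʳ (live p) = refl

∧ᵖ-zeroʳ : ∀ s → s ∧ᵖ fixed false ≡ fixed false
∧ᵖ-zeroʳ (fixed false) = refl
∧ᵖ-zeroʳ (fixed true) = refl
∧ᵖ-zeroʳ (live p) = refl

rankNode-shift : ∀ p q a b → suc p ≤ rankNode a b → suc (p + q) ≤ rankNode (a + q) (b + q)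
rankNode-shift p q a b h rewrite +-comm a q | +-comm b q | rankNode-+ q a b | +-comm p q =
  subst (_≤ q + rankNode a b) (+-suc q p) (+-monoʳ-≤ q h)

∧ᵖ-splitsˡ : ∀ {s s₀ s₁} t → Splits s s₀ s₁ → Splits (s ∧ᵖ t) (s₀ ∧ᵖ t) (s₁ ∧ᵖ t)
∧ᵖ-splitsˡ {fixed false} t (refl , refl) = splits-refl (fixed false)
∧ᵖ-splitsˡ {fixed true} t (refl , refl) = splits-refl t
∧ᵖ-splitsˡ {live p} {s₀} {s₁} (fixed false)
  rewrite ∧ᵖ-zeroʳ s₀ | ∧ᵖ-zeroʳ s₁ = λ _ → refl , refl
∧ᵖ-splitsˡ {live p} {s₀} {s₁} (fixed true)
  rewrite ∧ᵖ-identityʳ s₀ | ∧ᵖ-identityʳ s₁ = λ h → h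
∧ᵖ-splitsˡ {live p} {fixed false} {fixed false} (live q) (_ , ne) = ⊥-elim (ne refl)
∧ᵖ-splitsˡ {live p} {fixed false} {fixed true} (live q) (s≤s z≤n , _) = ≤-refl , tt
∧ᵖ-splitsˡ {live p} {fixed false} {live p₁} (live q) (h , _) = s≤s (+-monoˡ-≤ q (s≤s⁻¹ h)) , tt
∧ᵖ-splitsˡ {live p} {fixed true} {fixed false} (live q) (s≤s z≤n , _) = ≤-refl , tt
∧ᵖ-splitsˡ {live p} {fixed true} {fixed true} (live q) (_ , ne) = ⊥-elim (ne refl)
∧ᵖ-splitsˡ {live p} {fixed true} {live p₁} (live q) (h , _) =
  ≤-trans (s≤s (+-monoˡ-≤ q (s≤s⁻¹ h))) (s≤s (b≤rankNode q (p₁ + q))) , tt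
∧ᵖ-splitsˡ {live p} {live p₀} {fixed false} (live q) (h , _) = s≤s (+-monoˡ-≤ q (s≤s⁻¹ h)) , tt
∧ᵖ-splitsˡ {live p} {live p₀} {fixed true} (live q) (h , _) =
  ≤-trans (s≤s (+-monoˡ-≤ q (s≤s⁻¹ h))) (s≤s (a≤rankNode (p₀ + q) q)) , tt
∧ᵖ-splitsˡ {live p} {live p₀} {live p₁} (live q) (h , _) =
  rankNode-shift p q (suc p₀) (suc p₁) h , tt

∧ᵖ-splitsʳ : ∀ s {t t₀ t₁} → Splits t t₀ t₁ → Splits (s ∧ᵖ t) (s ∧ᵖ t₀) (s ∧ᵖ t₁)
∧ᵖ-splitsʳ s {t} {t₀} {t₁} rewrite ∧ᵖ-comm s t | ∧ᵖ-comm s t₀ | ∧ᵖ-comm s t₁ = ∧ᵖ-splitsˡ s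

weight-¬ᵖ : ∀ s → weight (¬ᵖ s) ≡ weight s
weight-¬ᵖ (fixed _) = refl
weight-¬ᵖ (live _) = refl

notSameFixed-¬ᵖ : ∀ s₀ s₁ → NotSameFixed s₀ s₁ → NotSameFixed (¬ᵖ s₀) (¬ᵖ s₁)
notSameFixed-¬ᵖ (fixed b₀) (fixed b₁) ne = ne ∘ not-injective
notSameFixed-¬ᵖ (fixed _) (live _) _ = tt
notSameFixed-¬ᵖ (live _) _ _ = tt

¬ᵖ-splits : ∀ {s s₀ s₁} → Splits s s₀ s₁ → Splits (¬ᵖ s) (¬ᵖ s₀) (¬ᵖ s₁)
¬ᵖ-splits {fixed b} (refl , refl) = refl , refl
¬ᵖ-splits {live p} {s₀} {s₁} (h , ne) =
  subst₂ (λ w₀ w₁ → suc p ≤ rankNode w₀ w₁) (sym (weight-¬ᵖ s₀)) (sym (weight-¬ᵖ s₁)) h ,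
  notSameFixed-¬ᵖ s₀ s₁ ne

∨ᵖ-splitsˡ : ∀ {s s₀ s₁} t → Splits s s₀ s₁ → Splits (s ∨ᵖ t) (s₀ ∨ᵖ t) (s₁ ∨ᵖ t)
∨ᵖ-splitsˡ t = ¬ᵖ-splits ∘ ∧ᵖ-splitsˡ (¬ᵖ t) ∘ ¬ᵖ-splits

∨ᵖ-splitsʳ : ∀ s {t t₀ t₁} → Splits t t₀ t₁ → Splits (s ∨ᵖ t) (s ∨ᵖ t₀) (s ∨ᵖ t₁)
∨ᵖ-splitsʳ s = ¬ᵖ-splits ∘ ∧ᵖ-splitsʳ (¬ᵖ s) ∘ ¬ᵖ-splits

attained : ∀ s → Σ Bool (Attains s)
attained (fixed b) = b , refl
attained (live _) = false , tt

∧ᵖ-sound : ∀ s t {a b} → Attains s a → Attains t b → Attains (s ∧ᵖ t) (a ∧ b)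
∧ᵖ-sound (fixed false) t refl _ = refl
∧ᵖ-sound (fixed true) t refl hb = hb
∧ᵖ-sound (live p) (fixed false) {a} _ refl = ∧-zeroʳ a
∧ᵖ-sound (live p) (fixed true) _ refl = tt
∧ᵖ-sound (live p) (live q) _ _ = tt

∧ᵖ-complete : ∀ s t {v} → Attains (s ∧ᵖ t) v →
  ∃₂ λ a b → Attains s a × Attains t b × a ∧ b ≡ v
∧ᵖ-complete (fixed false) t refl = let b , hb = attained t in false , b , refl , hb , refl
∧ᵖ-complete (fixed true) t {v} h = true , v , refl , h , refl
∧ᵖ-complete (live p) (fixed false) refl = true , false , tt , refl , refl
∧ᵖ-complete (live p) (fixed true) {v} _ = v , true , tt , refl , ∧-identityʳ v
∧ᵖ-complete (live p) (live q) {v} _ = v , true , tt , tt , ∧-identityʳ v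

¬ᵖ-attains : ∀ s {v} → Attains s v → Attains (¬ᵖ s) (not v)
¬ᵖ-attains (fixed b) refl = refl
¬ᵖ-attains (live p) _ = tt

¬ᵖ-attains⁻ : ∀ s {v} → Attains (¬ᵖ s) v → Attains s (not v)
¬ᵖ-attains⁻ (fixed b) refl = not-involutive b
¬ᵖ-attains⁻ (live p) _ = tt

not-∧-not : ∀ a b → not (not a ∧ not b) ≡ a ∨ b
not-∧-not false b = not-involutive b
not-∧-not true b = refl

∨ᵖ-sound : ∀ s t {a b} → Attains s a → Attains t b → Attains (s ∨ᵖ t) (a ∨ b)
∨ᵖ-sound s t {a} {b} ha hb = subst (Attains (s ∨ᵖ t)) (not-∧-not a b)
  (¬ᵖ-attains (¬ᵖ s ∧ᵖ ¬ᵖ t) (∧ᵖ-sound (¬ᵖ s) (¬ᵖ t) (¬ᵖ-attains s ha) (¬ᵖ-attains t hb)))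

∨ᵖ-complete : ∀ s t {v} → Attains (s ∨ᵖ t) v →
  ∃₂ λ a b → Attains s a × Attains t b × a ∨ b ≡ v
∨ᵖ-complete s t {v} h
  with a , b , ha , hb , a∧b≡¬v ← ∧ᵖ-complete (¬ᵖ s) (¬ᵖ t) (¬ᵖ-attains⁻ (¬ᵖ s ∧ᵖ ¬ᵖ t) h) =
  not a , not b , ¬ᵖ-attains⁻ s ha , ¬ᵖ-attains⁻ t hb , (begin
    not a ∨ not b              ≡⟨ not-∧-not (not a) (not b) ⟨
    not (not (not a) ∧ not (not b))
                               ≡⟨ cong₂ (λ x y → not (x ∧ y)) (not-involutive a) (not-involutive b) ⟩
    not (a ∧ b)                ≡⟨ cong not a∧b≡¬v ⟩
    not (not v)                ≡⟨ not-involutive v ⟩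
    v                          ∎)
  where open ≡-Reasoning

-- Restrictions and the adversary bound on rank

infixl 6 _[_]≔_

_[_]≔_ : ∀ {n} {A : Set} → (Fin n → A) → Fin n → A → Fin n → A
x [ i ]≔ v = updateAt x i (const v)

Restriction : ℕ → Set
Restriction n = Fin n → Maybe Bool

unrestricted : ∀ {n} → Restriction n
unrestricted _ = nothing

Extends : ∀ {n} → Restriction n → Input n → Set
Extends {n} ρ x = ∀ (i : Fin n) {b} → ρ i ≡ just b → x i ≡ b

Describes : ∀ {n} → BoolFn n → Restriction n → Profile → Set
Describes {n} F ρ s =
  (∀ x → Extends ρ x → Attains s (F x)) ×
  (∀ v → Attains s v → Σ (Input n) λ x → Extends ρ x × F x ≡ v)

SplitsAt : ∀ {n} → (Restriction n → Profile) → Restriction n → Fin n → Set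
SplitsAt π ρ i = Splits (π ρ) (π (ρ [ i ]≔ just false)) (π (ρ [ i ]≔ just true))

record Potential {n} (F : BoolFn n) : Set where
  field
    profile      : Restriction n → Profile
    profile-cong : ∀ {ρ ρ'} → ρ ≗ ρ' → profile ρ ≡ profile ρ'
    describes    : ∀ ρ → Describes F ρ (profile ρ)
    splits       : ∀ ρ i → ρ i ≡ nothing → SplitsAt profile ρ i

ComputesOn : ∀ {n} → DTree n → BoolFn n → Restriction n → Set
ComputesOn t F ρ = ∀ x → Extends ρ x → eval t x ≡ F x

branch : ∀ {n} → Bool → DTree n → DTree n → DTree n
branch b t₀ t₁ = if b then t₁ else t₀

rank-branch : ∀ {n} i b (t₀ t₁ : DTree n) → rank (branch b t₀ t₁) ≤ rank (query i t₀ t₁)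
rank-branch i false t₀ t₁ = a≤rankNode (rank t₀) (rank t₁)
rank-branch i true t₀ t₁ = b≤rankNode (rank t₀) (rank t₁)

eval-query : ∀ {n} i (t₀ t₁ : DTree n) {x b} → x i ≡ b →
  eval (query i t₀ t₁) x ≡ eval (branch b t₀ t₁) x
eval-query i t₀ t₁ {b = false} xi≡b rewrite xi≡b = refl
eval-query i t₀ t₁ {b = true} xi≡b rewrite xi≡b = refl

computesOn-branch : ∀ {n} {F : BoolFn n} {ρ ρ'} i b (t₀ t₁ : DTree n) →
  (∀ x → Extends ρ' x → Extends ρ x × x i ≡ b) →
  ComputesOn (query i t₀ t₁) F ρ → ComputesOn (branch b t₀ t₁) F ρ'
computesOn-branch i b t₀ t₁ narrow comp x ext =
  let ext' , xi≡b = narrow x ext in trans (sym (eval-query i t₀ t₁ xi≡b)) (comp x ext')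

extends-fix : ∀ {n} {ρ : Restriction n} {i b x} → ρ i ≡ nothing →
  Extends (ρ [ i ]≔ just b) x → Extends ρ x × x i ≡ b
extends-fix {ρ = ρ} {i} {b} ρi≡nothing ext = ext-ρ , ext i (updateAt-updates i ρ)
  where
  ext-ρ : Extends ρ _
  ext-ρ j ρj≡just with j ≟ i
  ... | yes refl with () ← trans (sym ρi≡nothing) ρj≡just
  ... | no j≢i = ext j (trans (updateAt-minimal j i ρ j≢i) ρj≡just)

module _ {n} {F : BoolFn n} (P : Potential F) where
  open Potential P

  weight≤rank : ∀ ρ t → ComputesOn t F ρ → weight (profile ρ) ≤ rank t
  weight≤rank ρ (leaf b) comp with profile ρ | describes ρ
  ... | fixed _ | _ = z≤n
  ... | live _ | _ , attains with x , ext , Fx≡¬b ← attains (not b) tt =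
    ⊥-elim (not-¬ refl (trans (comp x ext) Fx≡¬b))
  weight≤rank ρ (query i t₀ t₁) comp = byQueried (ρ i) refl
    where
    IH : ∀ b {ρ'} → ComputesOn (branch b t₀ t₁) F ρ' → weight (profile ρ') ≤ rank (branch b t₀ t₁)
    IH false = weight≤rank _ t₀
    IH true = weight≤rank _ t₁

    byBranches : ρ i ≡ nothing → ∀ s →
      Splits s (profile (ρ [ i ]≔ just false)) (profile (ρ [ i ]≔ just true)) →
      weight s ≤ rank (query i t₀ t₁)
    byBranches _ (fixed _) _ = z≤n
    byBranches ρi≡ (live _) (h , _) = ≤-trans h (rankNode-mono-≤
      (IH false (computesOn-branch i false t₀ t₁ (λ x → extends-fix ρi≡) comp))
      (IH true (computesOn-branch i true t₀ t₁ (λ x → extends-fix ρi≡) comp)))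

    byQueried : ∀ r → ρ i ≡ r → weight (profile ρ) ≤ rank (query i t₀ t₁)
    byQueried (just b) ρi≡ = ≤-trans
      (IH b (computesOn-branch i b t₀ t₁ (λ x ext → ext , ext i ρi≡) comp))
      (rank-branch i b t₀ t₁)
    byQueried nothing ρi≡ = byBranches ρi≡ (profile ρ) (splits ρ i ρi≡)

-- Composition

block : ∀ {a m} {A : Set} → (Fin (a * m) → A) → Fin a → Fin m → A
block x i j = x (combine i j)

glue : ∀ {a m} {A : Set} → (Fin a → Fin m → A) → Fin (a * m) → A
glue {a} {m} y w = uncurry y (remQuot {a} m w)

block-glue : ∀ {a m} {A : Set} (y : Fin a → Fin m → A) i → block (glue y) i ≗ y i
block-glue y i j = cong (uncurry y) (remQuot-combine i j)

block-update-same : ∀ {a m} {A : Set} (x : Fin (a * m) → A) (i : Fin a) (j : Fin m) v →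
  block (x [ combine i j ]≔ v) i ≗ block {a} x i [ j ]≔ v
block-update-same {a} x i j v j' with j' ≟ j
... | yes refl = trans (updateAt-updates (combine i j) x) (sym (updateAt-updates j (block {a} x i)))
... | no j'≢j = trans (updateAt-minimal _ _ x (j'≢j ∘ combine-injectiveʳ i j' i j))
                      (sym (updateAt-minimal j' j (block {a} x i) j'≢j))

block-update-other : ∀ {a m} {A : Set} (x : Fin (a * m) → A) {i i' : Fin a} (j : Fin m) v → i' ≢ i →
  block (x [ combine i j ]≔ v) i' ≗ block {a} x i'
block-update-other x {i} {i'} j v i'≢i j' =
  updateAt-minimal _ _ x (i'≢i ∘ combine-injectiveˡ i' j' i j)

Congruent : ∀ {n} → BoolFn n → Set
Congruent {n} F = ∀ {x y : Input n} → x ≗ y → F x ≡ F y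

⊚-cong : ∀ {a m} {f : BoolFn a} {g : BoolFn m} → Congruent f → Congruent g → Congruent (f ⊚ g)
⊚-cong f-cong g-cong x≗y = f-cong λ i → g-cong λ j → x≗y (combine i j)

record Combiner {a} (f : BoolFn a) (H : (Fin a → Profile) → Profile) : Set where
  field
    congruent : ∀ {σ τ} → σ ≗ τ → H σ ≡ H τ
    sound     : ∀ σ t → (∀ i → Attains (σ i) (t i)) → Attains (H σ) (f t)
    complete  : ∀ σ v → Attains (H σ) v →
                Σ (Input a) λ t → (∀ i → Attains (σ i) (t i)) × f t ≡ v
    splitsAt  : ∀ σ i {s₀ s₁} → Splits (σ i) s₀ s₁ →
                Splits (H σ) (H (σ [ i ]≔ s₀)) (H (σ [ i ]≔ s₁))

module _ {a m} {f : BoolFn a} {g : BoolFn m} {H : (Fin a → Profile) → Profile}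
         (C : Combiner f H) (f-cong : Congruent f) (g-cong : Congruent g) (P : Potential g) where
  open Combiner C
  open Potential P

  blockProfiles : Restriction (a * m) → Fin a → Profile
  blockProfiles ρ i = profile (block ρ i)

  ⊚-describes : ∀ ρ → Describes (f ⊚ g) ρ (H (blockProfiles ρ))
  ⊚-describes ρ = attains , attained-by
    where
    attains : ∀ x → Extends ρ x → Attains (H (blockProfiles ρ)) ((f ⊚ g) x)
    attains x ext = sound (blockProfiles ρ) _ λ i →
      proj₁ (describes (block ρ i)) (block x i) (λ j → ext (combine i j))

    attained-by : ∀ v → Attains (H (blockProfiles ρ)) v →
      Σ (Input (a * m)) λ x → Extends ρ x × (f ⊚ g) x ≡ v
    attained-by v h with t , ht , ft≡v ← complete (blockProfiles ρ) v h =
      glue y , ext , trans (f-cong λ i → trans (g-cong (block-glue y i)) (gy≡t i)) ft≡v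
      where
      witness : ∀ i → Σ (Input m) λ y → Extends (block ρ i) y × g y ≡ t i
      witness i = proj₂ (describes (block ρ i)) (t i) (ht i)
      y : Fin a → Input m
      y i = proj₁ (witness i)
      gy≡t : ∀ i → g (y i) ≡ t i
      gy≡t i = proj₂ (proj₂ (witness i))
      ext : Extends ρ (glue y)
      ext w ρw≡ = proj₁ (proj₂ (witness _)) _ (trans (cong ρ (combine-remQuot {a} m w)) ρw≡)

  blockProfiles-update : ∀ ρ i j v →
    blockProfiles (ρ [ combine i j ]≔ v) ≗ blockProfiles ρ [ i ]≔ profile (block ρ i [ j ]≔ v)
  blockProfiles-update ρ i j v i' with i' ≟ i
  ... | yes refl = trans (profile-cong (block-update-same ρ i j v))
                         (sym (updateAt-updates i (blockProfiles ρ)))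
  ... | no i'≢i = trans (profile-cong (block-update-other ρ j v i'≢i))
                        (sym (updateAt-minimal i' i (blockProfiles ρ) i'≢i))

  ⊚-splitsAt-combine : ∀ ρ i j → ρ (combine i j) ≡ nothing →
    SplitsAt (H ∘ blockProfiles) ρ (combine i j)
  ⊚-splitsAt-combine ρ i j ρij≡nothing = subst₂ (Splits (H (blockProfiles ρ)))
    (congruent (sym ∘ blockProfiles-update ρ i j (just false)))
    (congruent (sym ∘ blockProfiles-update ρ i j (just true)))
    (splitsAt (blockProfiles ρ) i (splits (block ρ i) j ρij≡nothing))

  ⊚-splits : ∀ ρ w → ρ w ≡ nothing → SplitsAt (H ∘ blockProfiles) ρ w
  ⊚-splits ρ w = subst (λ w → ρ w ≡ nothing → SplitsAt (H ∘ blockProfiles) ρ w)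
    (combine-remQuot {a} m w) (uncurry (⊚-splitsAt-combine ρ) (remQuot {a} m w))

  ⊚-potential : Potential (f ⊚ g)
  ⊚-potential = record
    { profile      = H ∘ blockProfiles
    ; profile-cong = λ ρ≗ρ' → congruent λ i → profile-cong λ j → ρ≗ρ' (combine i j)
    ; describes    = ⊚-describes
    ; splits       = ⊚-splits
    }

-- Profiles of the tensor powers of AND₂ ∘ OR₂

at4 : {A B : Set} → (A → A → A → A → B) → (Fin 4 → A) → B
at4 h σ = h (σ 0F) (σ 1F) (σ 2F) (σ 3F)

at4-cong : {A B : Set} (h : A → A → A → A → B) {σ τ : Fin 4 → A} → σ ≗ τ → at4 h σ ≡ at4 h τ
at4-cong h e rewrite e 0F | e 1F | e 2F | e 3F = refl

andOr-cong : Congruent andOr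
andOr-cong = at4-cong (λ a b c d → (a ∨ b) ∧ (c ∨ d))

andOrᵖ : Profile → Profile → Profile → Profile → Profile
andOrᵖ a b c d = (a ∨ᵖ b) ∧ᵖ (c ∨ᵖ d)

andOrCombiner : Combiner andOr (at4 andOrᵖ)
andOrCombiner = record
  { congruent = at4-cong andOrᵖ
  ; sound     = λ σ t h → ∧ᵖ-sound _ _ (∨ᵖ-sound _ _ (h 0F) (h 1F)) (∨ᵖ-sound _ _ (h 2F) (h 3F))
  ; complete  = complete
  ; splitsAt  = splitsAt
  }
  where
  complete : ∀ σ v → Attains (at4 andOrᵖ σ) v →
    Σ (Input 4) λ t → (∀ i → Attains (σ i) (t i)) × andOr t ≡ v
  complete σ v h =
    let u₀ , u₁ , h₀₁ , h₂₃ , u₀∧u₁≡v = ∧ᵖ-complete _ _ h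
        t₀ , t₁ , h₀ , h₁ , t₀∨t₁≡u₀ = ∨ᵖ-complete _ _ h₀₁
        t₂ , t₃ , h₂ , h₃ , t₂∨t₃≡u₁ = ∨ᵖ-complete _ _ h₂₃
        attains : ∀ i → Attains (σ i) ((lookup (t₀ ∷ t₁ ∷ t₂ ∷ t₃ ∷ [])) i)
        attains = λ { 0F → h₀ ; 1F → h₁ ; 2F → h₂ ; 3F → h₃ }
    in (lookup (t₀ ∷ t₁ ∷ t₂ ∷ t₃ ∷ [])) , attains , trans (cong₂ _∧_ t₀∨t₁≡u₀ t₂∨t₃≡u₁) u₀∧u₁≡v

  splitsAt : ∀ σ i {s₀ s₁} → Splits (σ i) s₀ s₁ →
    Splits (at4 andOrᵖ σ) (at4 andOrᵖ (σ [ i ]≔ s₀)) (at4 andOrᵖ (σ [ i ]≔ s₁))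
  splitsAt σ 0F = ∧ᵖ-splitsˡ (σ 2F ∨ᵖ σ 3F) ∘ ∨ᵖ-splitsˡ (σ 1F)
  splitsAt σ 1F = ∧ᵖ-splitsˡ (σ 2F ∨ᵖ σ 3F) ∘ ∨ᵖ-splitsʳ (σ 0F)
  splitsAt σ 2F = ∧ᵖ-splitsʳ (σ 0F ∨ᵖ σ 1F) ∘ ∨ᵖ-splitsˡ (σ 3F)
  splitsAt σ 3F = ∧ᵖ-splitsʳ (σ 0F ∨ᵖ σ 1F) ∘ ∨ᵖ-splitsʳ (σ 2F)

shape : Profile → Maybe Bool
shape (fixed b) = just b
shape (live _) = nothing

fromShape : Maybe Bool → Profile
fromShape (just b) = fixed b
fromShape nothing = live 0

shape-fromShape : ∀ m → shape (fromShape m) ≡ m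
shape-fromShape (just b) = refl
shape-fromShape nothing = refl

attains-shape : ∀ {s s' v} → shape s ≡ shape s' → Attains s v → Attains s' v
attains-shape {fixed b} {fixed .b} refl h = h
attains-shape {live _} {live _} _ _ = tt

splits-shape : ∀ {s s₀ s₁} → Splits s s₀ s₁ →
  Splits (fromShape (shape s)) (fromShape (shape s₀)) (fromShape (shape s₁))
splits-shape {fixed b} (refl , refl) = refl , refl
splits-shape {live p} {s₀} {s₁} (_ , ne) =
  1≤rankNode (weight (fromShape (shape s₀))) (weight (fromShape (shape s₁))) ,
  notSameFixed-shape s₀ s₁ ne
  where
  notSameFixed-shape : ∀ s₀ s₁ → NotSameFixed s₀ s₁ →
    NotSameFixed (fromShape (shape s₀)) (fromShape (shape s₁))
  notSameFixed-shape (fixed _) (fixed _) ne = ne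
  notSameFixed-shape (fixed _) (live _) _ = tt
  notSameFixed-shape (live _) _ _ = tt

-- (x₀ ∨ x₁) ∧ (x₂ ∨ x₃) has rank 2, one more than andOrᵖ derives from four
-- live 0.  Weights are forgotten, which loses nothing on the profiles of single
-- variables (fixed b or live 0), the only ones base is applied to.
baseᵖ : Maybe Bool → Maybe Bool → Maybe Bool → Maybe Bool → Profile
baseᵖ nothing nothing nothing nothing = live 1
baseᵖ a b c d = andOrᵖ (fromShape a) (fromShape b) (fromShape c) (fromShape d)

shape-baseᵖ : ∀ a b c d →
  shape (baseᵖ a b c d) ≡ shape (andOrᵖ (fromShape a) (fromShape b) (fromShape c) (fromShape d))
shape-baseᵖ (just _) b c d = refl
shape-baseᵖ nothing (just _) c d = refl
shape-baseᵖ nothing nothing (just _) d = refl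
shape-baseᵖ nothing nothing nothing (just _) = refl
shape-baseᵖ nothing nothing nothing nothing = refl

_≟ᵖ_ : (s t : Profile) → Dec (s ≡ t)
fixed b ≟ᵖ fixed b' = map′ (cong fixed) (λ { refl → refl }) (b Bool.≟ b')
fixed _ ≟ᵖ live _ = no λ ()
live _ ≟ᵖ fixed _ = no λ ()
live p ≟ᵖ live q = map′ (cong live) (λ { refl → refl }) (p ℕ.≟ q)

notSameFixed? : ∀ s t → Dec (NotSameFixed s t)
notSameFixed? (fixed b) (fixed b') = ¬? (b Bool.≟ b')
notSameFixed? (fixed _) (live _) = yes tt
notSameFixed? (live _) _ = yes tt

splits? : ∀ s s₀ s₁ → Dec (Splits s s₀ s₁)
splits? (fixed b) s₀ s₁ = (s₀ ≟ᵖ fixed b) ×-dec (s₁ ≟ᵖ fixed b)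
splits? (live p) s₀ s₁ = (suc p ℕ.≤? rankNode (weight s₀) (weight s₁)) ×-dec notSameFixed? s₀ s₁

∀-shape? : {P : Maybe Bool → Set} → (∀ m → Dec (P m)) → Dec (∀ m → P m)
∀-shape? P? = map′ (λ (pn , pf , pt) → λ { nothing → pn ; (just false) → pf ; (just true) → pt })
                   (λ h → h nothing , h (just false) , h (just true))
                   (P? nothing ×-dec P? (just false) ×-dec P? (just true))

baseᵖ-splits : ∀ i a b c d m₀ m₁ → let τ = lookup (a ∷ b ∷ c ∷ d ∷ []) in
  Splits (fromShape (τ i)) (fromShape m₀) (fromShape m₁) →
  Splits (at4 baseᵖ τ) (at4 baseᵖ (τ [ i ]≔ m₀)) (at4 baseᵖ (τ [ i ]≔ m₁))
baseᵖ-splits = from-yes (all? λ i → ∀-shape? λ a → ∀-shape? λ b → ∀-shape? λ c → ∀-shape? λ d →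
  ∀-shape? λ m₀ → ∀-shape? λ m₁ → let τ = lookup (a ∷ b ∷ c ∷ d ∷ []) in
  splits? (fromShape (τ i)) (fromShape m₀) (fromShape m₁) →-dec
  splits? (at4 baseᵖ τ) (at4 baseᵖ (τ [ i ]≔ m₀)) (at4 baseᵖ (τ [ i ]≔ m₁)))

base : (Fin 4 → Profile) → Profile
base σ = at4 baseᵖ (shape ∘ σ)

shape-base : ∀ σ → shape (base σ) ≡ shape (at4 andOrᵖ (fromShape ∘ shape ∘ σ))
shape-base σ = shape-baseᵖ (shape (σ 0F)) (shape (σ 1F)) (shape (σ 2F)) (shape (σ 3F))

baseCombiner : Combiner andOr base
baseCombiner = record
  { congruent = λ e → at4-cong baseᵖ (cong shape ∘ e)
  ; sound     = sound
  ; complete  = complete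
  ; splitsAt  = splitsAt
  }
  where
  module A = Combiner andOrCombiner

  sound : ∀ σ t → (∀ i → Attains (σ i) (t i)) → Attains (base σ) (andOr t)
  sound σ t h = attains-shape (sym (shape-base σ))
    (A.sound (fromShape ∘ shape ∘ σ) t λ i →
      attains-shape (sym (shape-fromShape (shape (σ i)))) (h i))

  complete : ∀ σ v → Attains (base σ) v →
    Σ (Input 4) λ t → (∀ i → Attains (σ i) (t i)) × andOr t ≡ v
  complete σ v h =
    let t , ht , andOr-t≡v = A.complete (fromShape ∘ shape ∘ σ) v
                               (attains-shape (shape-base σ) h)
    in t , (λ i → attains-shape (shape-fromShape (shape (σ i))) (ht i)) , andOr-t≡v

  splitsAt : ∀ σ i {s₀ s₁} → Splits (σ i) s₀ s₁ →
    Splits (base σ) (base (σ [ i ]≔ s₀)) (base (σ [ i ]≔ s₁))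
  splitsAt σ i {s₀} {s₁} = atPosition i ∘ splits-shape
    where
    a = shape (σ 0F) ; b = shape (σ 1F) ; c = shape (σ 2F) ; d = shape (σ 3F)
    atPosition : ∀ i →
      Splits (fromShape (shape (σ i))) (fromShape (shape s₀)) (fromShape (shape s₁)) →
      Splits (base σ) (base (σ [ i ]≔ s₀)) (base (σ [ i ]≔ s₁))
    atPosition 0F = baseᵖ-splits 0F a b c d (shape s₀) (shape s₁)
    atPosition 1F = baseᵖ-splits 1F a b c d (shape s₀) (shape s₁)
    atPosition 2F = baseᵖ-splits 2F a b c d (shape s₀) (shape s₁)
    atPosition 3F = baseᵖ-splits 3F a b c d (shape s₀) (shape s₁)

var : BoolFn 1
var x = x 0F

var-cong : Congruent var
var-cong e = e 0F

varPotential : Potential var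
varPotential = record
  { profile      = λ ρ → fromShape (ρ 0F)
  ; profile-cong = λ e → cong fromShape (e 0F)
  ; describes    = describes
  ; splits       = λ { ρ 0F ρ0≡ →
                       subst (λ m → Splits (fromShape m) _ _) (sym ρ0≡) (s≤s z≤n , λ ()) }
  }
  where
  describes : ∀ ρ → Describes var ρ (fromShape (ρ 0F))
  describes ρ with ρ 0F in ρ0≡
  ... | just b = (λ x ext → ext 0F ρ0≡) ,
                 λ v v≡b → const b ,
                           (λ { 0F ρ0≡' → just-injective (trans (sym ρ0≡) ρ0≡') }) ,
                           sym v≡b
  ... | nothing = (λ _ _ → tt) ,
                  λ v _ → const v , (λ { 0F ρ0≡' → case trans (sym ρ0≡) ρ0≡' of λ () }) , refl

tensor-cong : ∀ k → Congruent (tensor andOr k)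
tensor-cong zero = ⊚-cong andOr-cong var-cong
tensor-cong (suc k) = ⊚-cong andOr-cong (tensor-cong k)

tensorPotential : ∀ k → Potential (tensor andOr k)
tensorPotential zero = ⊚-potential baseCombiner andOr-cong var-cong varPotential
tensorPotential (suc k) = ⊚-potential andOrCombiner andOr-cong (tensor-cong k) (tensorPotential k)

profile-unrestricted : ∀ k → Potential.profile (tensorPotential k) unrestricted ≡ live (4 ^ k)
profile-unrestricted zero = refl
profile-unrestricted (suc k) rewrite profile-unrestricted k = cong live (quadruple (4 ^ k))
  where
  quadruple : ∀ q → (q + q) + (q + q) ≡ 4 * q
  quadruple q = trans (+-assoc q q (q + q)) (cong (λ r → q + (q + (q + r))) (sym (+-identityʳ q)))

4^k<Rank : ∀ k {r} → IsRank (tensor andOr k) r → 4 ^ k < r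
4^k<Rank k ((t , computes , rank≡r) , _) =
  subst₂ _≤_ (cong weight (profile-unrestricted k)) rank≡r
    (weight≤rank (tensorPotential k) unrestricted t (λ x _ → computes x))

-- Monochromatic certificates

record MonoCertificate {n} (F : BoolFn n) (x : Input n) (v : Bool) (s : ℕ) : Set where
  field
    set           : Subset n
    certifies     : IsCertificate F x set
    monochromatic : ∀ i → i ∈ set → x i ≡ v
    small         : ∣ set ∣ ≤ s

-- C_v(F) ≤ s, witnessed by certificates on which the input is constantly v;
-- monochromaticity is what makes the bound multiplicative under composition.
MonoCertBound : ∀ {n} → BoolFn n → Bool → ℕ → Set
MonoCertBound F v s = ∀ x → F x ≡ v → MonoCertificate F x v s

∈-++⁺ˡ : ∀ {m n} {p : Subset m} (q : Subset n) {i} → i ∈ p → i ↑ˡ n ∈ p ++ q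
∈-++⁺ˡ q here = here
∈-++⁺ˡ q (there i∈p) = there (∈-++⁺ˡ q i∈p)

∈-++⁺ʳ : ∀ {m n} (p : Subset m) {q : Subset n} {j} → j ∈ q → m ↑ʳ j ∈ p ++ q
∈-++⁺ʳ [] j∈q = j∈q
∈-++⁺ʳ (_ ∷ p) j∈q = there (∈-++⁺ʳ p j∈q)

∈-++⁻ : ∀ {m n} (p : Subset m) {q : Subset n} {w} → w ∈ p ++ q →
  (Σ (Fin m) λ i → i ∈ p × w ≡ i ↑ˡ n) ⊎ (Σ (Fin n) λ j → j ∈ q × w ≡ m ↑ʳ j)
∈-++⁻ [] {w = w} w∈q = inj₂ (w , w∈q , refl)
∈-++⁻ (_ ∷ p) here = inj₁ (zero , here , refl)
∈-++⁻ (_ ∷ p) (there w∈) =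
  Sum.map (λ (i , i∈p , eq) → suc i , there i∈p , cong suc eq)
          (λ (j , j∈q , eq) → j , j∈q , cong suc eq)
          (∈-++⁻ p w∈)

∣++∣ : ∀ {m n} (p : Subset m) (q : Subset n) → ∣ p ++ q ∣ ≡ ∣ p ∣ + ∣ q ∣
∣++∣ [] q = refl
∣++∣ (outside ∷ p) q = ∣++∣ p q
∣++∣ (inside ∷ p) q = cong suc (∣++∣ p q)

blocks : ∀ {a m} (P : Subset a) → (∀ i → i ∈ P → Subset m) → Subset (a * m)
blocks [] S = []
blocks (inside ∷ P) S = S zero here ++ blocks P (λ i i∈P → S (suc i) (there i∈P))
blocks (outside ∷ P) S = ∅ ++ blocks P (λ i i∈P → S (suc i) (there i∈P))

∈-blocks⁺ : ∀ {a m} (P : Subset a) (S : ∀ i → i ∈ P → Subset m) {i} (i∈P : i ∈ P) {j} →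
  j ∈ S i i∈P → combine i j ∈ blocks P S
∈-blocks⁺ (inside ∷ P) S here j∈ = ∈-++⁺ˡ _ j∈
∈-blocks⁺ (inside ∷ P) S (there i∈P) j∈ = ∈-++⁺ʳ (S zero here) (∈-blocks⁺ P _ i∈P j∈)
∈-blocks⁺ {m = m} (outside ∷ P) S (there i∈P) j∈ = ∈-++⁺ʳ (∅ {m}) (∈-blocks⁺ P _ i∈P j∈)

∈-blocks⁻ : ∀ {a m} (P : Subset a) (S : ∀ i → i ∈ P → Subset m) {w} → w ∈ blocks P S →
  Σ (Fin a) λ i → Σ (i ∈ P) λ i∈P → Σ (Fin m) λ j → j ∈ S i i∈P × w ≡ combine i j
∈-blocks⁻ (inside ∷ P) S w∈ with ∈-++⁻ (S zero here) w∈
... | inj₁ (j , j∈ , refl) = zero , here , j , j∈ , refl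
... | inj₂ (w , w∈' , refl) =
  let i , i∈P , j , j∈ , w≡ = ∈-blocks⁻ P _ w∈' in suc i , there i∈P , j , j∈ , cong (_ ↑ʳ_) w≡
∈-blocks⁻ {m = m} (outside ∷ P) S w∈ with ∈-++⁻ (∅ {m}) w∈
... | inj₁ (_ , j∈∅ , _) = ⊥-elim (∉⊥ j∈∅)
... | inj₂ (w , w∈' , refl) =
  let i , i∈P , j , j∈ , w≡ = ∈-blocks⁻ P _ w∈' in suc i , there i∈P , j , j∈ , cong (_ ↑ʳ_) w≡

∣blocks∣≤ : ∀ {a m} (P : Subset a) (S : ∀ i → i ∈ P → Subset m) {s} →
  (∀ i i∈P → ∣ S i i∈P ∣ ≤ s) → ∣ blocks P S ∣ ≤ ∣ P ∣ * s
∣blocks∣≤ [] S _ = z≤n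
∣blocks∣≤ (inside ∷ P) S small = ≤-trans (≤-reflexive (∣++∣ (S zero here) _))
  (+-mono-≤ (small zero here) (∣blocks∣≤ P _ λ i i∈P → small (suc i) (there i∈P)))
∣blocks∣≤ {m = m} (outside ∷ P) S small = ≤-trans
  (≤-reflexive (trans (∣++∣ (∅ {m}) (blocks P S')) (cong (_+ ∣ blocks P S' ∣) (∣⊥∣≡0 m))))
  (∣blocks∣≤ P S' λ i i∈P → small (suc i) (there i∈P))
  where
  S' : ∀ i → i ∈ P → Subset m
  S' i i∈P = S (suc i) (there i∈P)

monoCertBound-⊚ : ∀ {a m} {f : BoolFn a} {g : BoolFn m} {v c s} →
  MonoCertBound f v c → MonoCertBound g v s → MonoCertBound (f ⊚ g) v (c * s)
monoCertBound-⊚ {m = m} {g = g} {v} {s = s} boundf boundg x fgx≡v = record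
  { set           = blocks set S
  ; certifies     = λ x' agree → certifies (λ i → g (block x' i)) λ i i∈P →
      MonoCertificate.certifies (inner i i∈P) (block x' i) λ j j∈ →
        agree (combine i j) (∈-blocks⁺ set S i∈P j∈)
  ; monochromatic = monochromatic-blocks
  ; small         = ≤-trans (∣blocks∣≤ set S λ i i∈P → MonoCertificate.small (inner i i∈P))
                            (*-monoˡ-≤ s small)
  }
  where
  open MonoCertificate (boundf (λ i → g (block x i)) fgx≡v)

  inner : ∀ i → i ∈ set → MonoCertificate g (block x i) v s
  inner i i∈P = boundg (block x i) (monochromatic i i∈P)

  S : ∀ i → i ∈ set → Subset m
  S i i∈P = MonoCertificate.set (inner i i∈P)

  monochromatic-blocks : ∀ w → w ∈ blocks set S → x w ≡ v
  monochromatic-blocks w w∈ with i , i∈P , j , j∈ , refl ← ∈-blocks⁻ set S w∈ =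
    MonoCertificate.monochromatic (inner i i∈P) j j∈

singleton-monoCertificate : ∀ {n} {F : BoolFn n} {x v} i → x i ≡ v → F x ≡ v →
  (∀ x' → x' i ≡ v → F x' ≡ v) → MonoCertificate F x v 1
singleton-monoCertificate i xi≡v Fx≡v decides = record
  { set           = ⁅ i ⁆
  ; certifies     = λ x' agree → trans (decides x' (trans (agree i (x∈⁅x⁆ i)) xi≡v)) (sym Fx≡v)
  ; monochromatic = λ j j∈ → trans (cong _ (x∈⁅y⁆⇒x≡y i j∈)) xi≡v
  ; small         = ≤-reflexive (∣⁅x⁆∣≡1 i)
  }

full-monoCertificate : ∀ {n} {F : BoolFn n} {x v} → Congruent F → (∀ i → x i ≡ v) →
  MonoCertificate F x v n
full-monoCertificate {n} F-cong constant = record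
  { set           = ⊤
  ; certifies     = λ x' agree → F-cong λ i → agree i ∈⊤
  ; monochromatic = λ i _ → constant i
  ; small         = ≤-reflexive (∣⊤∣≡n n)
  }

and₂ or₂ : BoolFn 2
and₂ x = x 0F ∧ x 1F
or₂ x = x 0F ∨ x 1F

and₂-true : MonoCertBound and₂ true 2
and₂-true x x₀∧x₁≡true = full-monoCertificate (λ e → cong₂ _∧_ (e 0F) (e 1F)) λ where
  0F → ∧-conicalˡ _ _ x₀∧x₁≡true
  1F → ∧-conicalʳ _ _ x₀∧x₁≡true

and₂-false : MonoCertBound and₂ false 1
and₂-false x x₀∧x₁≡false = byFirst (x 0F) refl
  where
  byFirst : ∀ b → x 0F ≡ b → MonoCertificate and₂ x false 1
  byFirst false x₀≡ = singleton-monoCertificate 0F x₀≡ x₀∧x₁≡false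
    λ x' x'₀≡ → cong (_∧ x' 1F) x'₀≡
  byFirst true x₀≡ =
    singleton-monoCertificate 1F (trans (cong (_∧ x 1F) (sym x₀≡)) x₀∧x₁≡false) x₀∧x₁≡false
    λ x' x'₁≡ → trans (cong (x' 0F ∧_) x'₁≡) (∧-zeroʳ (x' 0F))

or₂-false : MonoCertBound or₂ false 2
or₂-false x x₀∨x₁≡false = full-monoCertificate (λ e → cong₂ _∨_ (e 0F) (e 1F)) λ where
  0F → ∨-conicalˡ _ _ x₀∨x₁≡false
  1F → ∨-conicalʳ _ _ x₀∨x₁≡false

or₂-true : MonoCertBound or₂ true 1
or₂-true x x₀∨x₁≡true = byFirst (x 0F) refl
  where
  byFirst : ∀ b → x 0F ≡ b → MonoCertificate or₂ x true 1
  byFirst true x₀≡ = singleton-monoCertificate 0F x₀≡ x₀∨x₁≡true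
    λ x' x'₀≡ → cong (_∨ x' 1F) x'₀≡
  byFirst false x₀≡ =
    singleton-monoCertificate 1F (trans (cong (_∨ x 1F) (sym x₀≡)) x₀∨x₁≡true) x₀∨x₁≡true
    λ x' x'₁≡ → trans (cong (x' 0F ∨_) x'₁≡) (∨-zeroʳ (x' 0F))

-- andOr unfolds definitionally to and₂ ⊚ or₂.
andOr-monoCertBound : ∀ v → MonoCertBound andOr v 2
andOr-monoCertBound true = monoCertBound-⊚ {f = and₂} {g = or₂} and₂-true or₂-true
andOr-monoCertBound false = monoCertBound-⊚ {f = and₂} {g = or₂} and₂-false or₂-false

var-monoCertBound : ∀ v → MonoCertBound var v 1
var-monoCertBound v x x₀≡v = singleton-monoCertificate 0F x₀≡v x₀≡v λ _ x'₀≡v → x'₀≡v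

tensor-monoCertBound : ∀ k v → MonoCertBound (tensor andOr k) v (2 ^ suc k)
tensor-monoCertBound zero v = monoCertBound-⊚ (andOr-monoCertBound v) (var-monoCertBound v)
tensor-monoCertBound (suc k) v = monoCertBound-⊚ (andOr-monoCertBound v) (tensor-monoCertBound k v)

C≤2^[1+k] : ∀ k {c} → IsCert (tensor andOr k) c → c ≤ 2 ^ suc k
C≤2^[1+k] k ((x , _ , minimal) , _) = ≤-trans (minimal set certifies) small
  where open MonoCertificate (tensor-monoCertBound k _ x refl)

2^n*2^n≡4^n : ∀ n → 2 ^ n * 2 ^ n ≡ 4 ^ n
2^n*2^n≡4^n n = begin
  2 ^ n * 2 ^ n   ≡⟨ ^-distribˡ-+-* 2 n n ⟨
  2 ^ (n + n)     ≡⟨ cong (λ m → 2 ^ (n + m)) (+-identityʳ n) ⟨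
  2 ^ (2 * n)     ≡⟨ ^-*-assoc 2 2 n ⟨
  4 ^ n           ∎
  where open ≡-Reasoning

lemma5p10 : Σ ℕ λ p → Σ ℕ λ q → 0 < p × 0 < q ×
    (∀ (k : ℕ) (r c : ℕ) → IsRank (tensor andOr k) r → IsCert (tensor andOr k) c →
      p * (c * c) ≤ q * r)
lemma5p10 = 1 , 4 , s≤s z≤n , s≤s z≤n , λ k r c isRank isCert →
  let c≤ = C≤2^[1+k] k isCert in begin
    1 * (c * c)             ≡⟨ *-identityˡ (c * c) ⟩
    c * c                   ≤⟨ *-mono-≤ c≤ c≤ ⟩
    2 ^ suc k * 2 ^ suc k   ≡⟨ 2^n*2^n≡4^n (suc k) ⟩
    4 * 4 ^ k               ≤⟨ *-monoʳ-≤ 4 (<⇒≤ (4^k<Rank k isRank)) ⟩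
    4 * r                   ∎
  where open ≤-Reasoning
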